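{- For integers $d, s \geq 1$, let $M_d(s)$ denote the number of tuples $(X_1, X_2, \ldots, X_d)$ of twin-free sets with $X_d \subseteq X_{d-1} \subseteq \cdots \subseteq X_1 \subseteq \{1, 2, \ldots, s-1\}$. Then $M_d(1) = 1$, $M_d(2) = d+1$, and for all $s \geq 3$, $$M_d(s) = M_d(s-1) + d\, M_d(s-2).$$
   Context: A set $X \subseteq \mathbb{Z}$ is twin-free if there is no $x \in X$ with $\{x, x+1\} \subseteq X$. For $s = 1$ the set $\{1, \ldots, s-1\}$ is empty. -}

module Defs where

open import Data.Nat using (ℕ; zero; suc; _∸_)
open import Data.Bool using (Bool; true; false; _∧_; not; _∨_; T)
open import Data.Vec using (Vec; []; _∷_)
open import Data.Product using (Σ; _×_)
open import Data.Fin.Subset using (Subset)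
open import Data.Unit using (⊤)

-- A subset of {1,...,n} is a Subset n = Vec Bool n: position i (0-based)
-- records membership of the integer i+1.  Thus {1,...,s-1} ↔ Subset (s ∸ 1).

twinFreeᵇ : {n : ℕ} → Subset n → Bool
twinFreeᵇ [] = true
twinFreeᵇ (a ∷ []) = true
twinFreeᵇ (a ∷ b ∷ xs) = not (a ∧ b) ∧ twinFreeᵇ (b ∷ xs)

TwinFree : {n : ℕ} → Subset n → Set
TwinFree X = T (twinFreeᵇ X)

⊆ᵇ : {n : ℕ} → Subset n → Subset n → Bool
⊆ᵇ [] [] = true
⊆ᵇ (a ∷ xs) (b ∷ ys) = (not a ∨ b) ∧ ⊆ᵇ xs ys

IsChain : {n d : ℕ} → Vec (Subset n) d → Set
IsChain [] = ⊤
IsChain (X ∷ []) = TwinFree X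
IsChain (X ∷ Y ∷ Xs) = TwinFree X × (T (⊆ᵇ Y X) × IsChain (Y ∷ Xs))

Chains : ℕ → ℕ → Set
Chains d s = Σ (Vec (Subset (s ∸ 1)) d) IsChain

-- Read a tuple X₁ ⊇ ⋯ ⊇ X_k of subsets of {1,…,n} column by column: the
-- memberships of a point in X₁,…,X_k form a decreasing Boolean column, so there
-- are k + 1 possible columns, and since subsets of a twin-free set are twin-free
-- the tuple is admissible exactly when no two adjacent columns both meet X₁.
-- Peeling off the first column: either it is empty and the rest is arbitrary, or
-- it is one of k nonempty columns and the next column must be empty.  Counting
-- separately the tuples whose first column is forced to be empty turns this into
-- the recurrence.
module Submission where

open import Defs
open import Data.Nat using (ℕ; zero; suc; _+_; _*_; pred)
open import Data.Nat.Properties using (+-comm; *-identityʳ)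
open import Data.Bool using (Bool; true; false; _∧_; _∨_; not; T)
open import Data.Bool.Properties using (T-∧; T-irrelevant)
open import Data.Fin using (Fin; zero; suc)
open import Data.Fin.Properties using (+↔⊎; *↔×; 1↔⊤)
open import Data.Vec using (Vec; []; _∷_; head; tail; map; zipWith; replicate)
open import Data.Vec.Relation.Unary.Linked as Linked using (Linked; []; [-]; _∷_)
open import Data.Fin.Subset using (Subset)
open import Data.Unit using (⊤; tt)
open import Data.Empty using (⊥-elim)
open import Data.Sum using (_⊎_; inj₁; inj₂; [_,_]′)
open import Data.Product using (Σ; _×_; _,_; proj₁; proj₂; uncurry)
import Data.Product as Product
open import Data.Product.Properties using (∃∃↔∃∃)
import Data.Product.Function.Dependent.Propositional as Σ
open import Data.Product.Function.NonDependent.Propositional using (_×-↔_)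
open import Data.Sum.Function.Propositional using (_⊎-↔_)
open import Function using (_∘_; id)
open import Function.Bundles using (_↔_; _⇔_; mk↔ₛ′; mk⇔; Equivalence)
open import Function.Properties.Inverse using (↔-trans; ↔-sym; ↔-refl)
open import Function.Construct.Identity using (⇔-id)
open import Function.Related.Propositional using (K-reflexive; module EquationalReasoning)
open import Function.Related.TypeIsomorphisms using (Σ-assoc)
open import Relation.Binary.Core using (Rel)
open import Relation.Nullary using (¬_; Irrelevant)
open import Relation.Binary.PropositionalEquality using (_≡_; refl; sym; trans; cong; cong₂)

open Equivalence using (to; from)

×-irrelevant : {A B : Set} → Irrelevant A → Irrelevant B → Irrelevant (A × B)
×-irrelevant irrA irrB (a , b) (a′ , b′) = cong₂ _,_ (irrA a a′) (irrB b b′)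

irrelevant-⇔⇒↔ : {A B : Set} → Irrelevant A → Irrelevant B → A ⇔ B → A ↔ B
irrelevant-⇔⇒↔ irrA irrB A⇔B =
  mk↔ₛ′ (to A⇔B) (from A⇔B) (λ _ → irrB _ _) (λ _ → irrA _ _)

Σ-≡-irrelevant : {A : Set} {P : A → Set} → (∀ {x} → Irrelevant (P x)) →
                 {x y : A} {p : P x} {q : P y} → x ≡ y → _≡_ {A = Σ A P} (x , p) (y , q)
Σ-≡-irrelevant irr refl = cong (_ ,_) (irr _ _)

⊎-identityʳ-¬ : {A B : Set} → ¬ B → (A ⊎ B) ↔ A
⊎-identityʳ-¬ ¬b = mk↔ₛ′ [ id , ⊥-elim ∘ ¬b ]′ inj₁ (λ _ → refl)
  λ { (inj₁ _) → refl ; (inj₂ b) → ⊥-elim (¬b b) }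

Σ-Fin-suc : ∀ {n} {P : Fin (suc n) → Set} → Σ (Fin (suc n)) P ↔ (P zero ⊎ Σ (Fin n) (P ∘ suc))
Σ-Fin-suc = mk↔ₛ′
  (λ { (zero , p) → inj₁ p ; (suc i , p) → inj₂ (i , p) })
  [ (zero ,_) , Product.map suc id ]′
  (λ { (inj₁ _) → refl ; (inj₂ _) → refl })
  (λ { (zero , _) → refl ; (suc _ , _) → refl })

module _ {p q r} {A B C : Set} {P : Rel A p} {Q : Rel B q} {R : Rel C r} (f : A → B → C)
         (R⇔ : ∀ {a a′ b b′} → R (f a b) (f a′ b′) ⇔ (P a a′ × Q b b′)) where

  Linked-zipWith⁺ : ∀ {m} {as : Vec A m} {bs : Vec B m} →
                    Linked P as → Linked Q bs → Linked R (zipWith f as bs)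
  Linked-zipWith⁺ [] [] = []
  Linked-zipWith⁺ [-] [-] = [-]
  Linked-zipWith⁺ {as = _ ∷ _ ∷ _} {_ ∷ _ ∷ _} (p ∷ ps) (q ∷ qs) =
    from R⇔ (p , q) ∷ Linked-zipWith⁺ ps qs

  Linked-zipWith⁻ : ∀ {m} (as : Vec A m) (bs : Vec B m) →
                    Linked R (zipWith f as bs) → Linked P as × Linked Q bs
  Linked-zipWith⁻ [] [] _ = [] , []
  Linked-zipWith⁻ (_ ∷ []) (_ ∷ []) _ = [-] , [-]
  Linked-zipWith⁻ (_ ∷ as@(_ ∷ _)) (_ ∷ bs@(_ ∷ _)) (r ∷ rs) =
    Product.zip _∷_ _∷_ (to R⇔ r) (Linked-zipWith⁻ as bs rs)

Decreasing : ∀ {m} → Vec Bool m → Set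
Decreasing = Linked (λ a b → T (not b ∨ a))

decreasing-irrelevant : ∀ {m} {c : Vec Bool m} → Irrelevant (Decreasing c)
decreasing-irrelevant = Linked.irrelevant T-irrelevant

leadingTrues : ∀ {m} → Vec Bool m → Fin (suc m)
leadingTrues [] = zero
leadingTrues (false ∷ _) = zero
leadingTrues (true ∷ c) = suc (leadingTrues c)

staircase : ∀ {m} → Fin (suc m) → Vec Bool m
staircase {m} zero = replicate m false
staircase {suc m} (suc i) = true ∷ staircase i

replicate-false-decreasing : ∀ m → Decreasing (replicate m false)
replicate-false-decreasing zero = []
replicate-false-decreasing (suc zero) = [-]
replicate-false-decreasing (suc (suc m)) = tt ∷ replicate-false-decreasing (suc m)

true∷-decreasing : ∀ {m} {c : Vec Bool m} → Decreasing c → Decreasing (true ∷ c)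
true∷-decreasing {c = []} _ = [-]
true∷-decreasing {c = false ∷ _} d = tt ∷ d
true∷-decreasing {c = true ∷ _} d = tt ∷ d

staircase-decreasing : ∀ {m} (i : Fin (suc m)) → Decreasing (staircase i)
staircase-decreasing {m} zero = replicate-false-decreasing m
staircase-decreasing {suc m} (suc i) = true∷-decreasing (staircase-decreasing i)

leadingTrues-staircase : ∀ {m} (i : Fin (suc m)) → leadingTrues (staircase i) ≡ i
leadingTrues-staircase {zero} zero = refl
leadingTrues-staircase {suc m} zero = refl
leadingTrues-staircase {suc m} (suc i) = cong suc (leadingTrues-staircase i)

false∷-decreasing : ∀ {m} {c : Vec Bool m} → Decreasing (false ∷ c) → replicate m false ≡ c
false∷-decreasing {c = []} _ = refl
false∷-decreasing {c = false ∷ _} (_ ∷ d) = cong (false ∷_) (false∷-decreasing d)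
false∷-decreasing {c = true ∷ _} (() ∷ _)

staircase-leadingTrues : ∀ {m} {c : Vec Bool m} → Decreasing c → staircase (leadingTrues c) ≡ c
staircase-leadingTrues {c = []} _ = refl
staircase-leadingTrues {c = false ∷ _} d = cong (false ∷_) (false∷-decreasing d)
staircase-leadingTrues {c = true ∷ _} d = cong (true ∷_) (staircase-leadingTrues (Linked.tail d))

decreasing↔Fin : ∀ {m} → Σ (Vec Bool m) Decreasing ↔ Fin (suc m)
decreasing↔Fin = mk↔ₛ′ (leadingTrues ∘ proj₁) (λ i → staircase i , staircase-decreasing i)
  leadingTrues-staircase
  (λ (_ , d) → Σ-≡-irrelevant decreasing-irrelevant (staircase-leadingTrues d))

Σ-decreasing : ∀ {m} {F : Bool → Set} →
  Σ (Vec Bool (suc m)) (λ c → Decreasing c × F (head c)) ↔ (F false ⊎ Fin (suc m) × F true)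
Σ-decreasing {m} {F} = begin
  Σ (Vec Bool (suc m)) (λ c → Decreasing c × F (head c))
    ↔⟨ Σ-assoc ⟨
  Σ (Σ (Vec Bool (suc m)) Decreasing) (F ∘ head ∘ proj₁)
    ↔⟨ Σ.cong decreasing↔Fin
         (λ {(_ , d)} → K-reflexive (cong (F ∘ head) (sym (staircase-leadingTrues d)))) ⟩
  Σ (Fin (suc (suc m))) (F ∘ head ∘ staircase)
    ↔⟨ Σ-Fin-suc ⟩
  (F false ⊎ Fin (suc m) × F true) ∎
  where open EquationalReasoning

twinFree-⊆ : ∀ {n} (X Y : Subset n) → T (⊆ᵇ Y X) → TwinFree X → TwinFree Y
twinFree-⊆ [] [] _ _ = tt
twinFree-⊆ (_ ∷ []) (_ ∷ []) _ _ = tt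
twinFree-⊆ (_ ∷ X@(_ ∷ _)) (false ∷ Y@(_ ∷ _)) Y⊆X tf = twinFree-⊆ X Y Y⊆X (proj₂ (to T-∧ tf))
twinFree-⊆ (true ∷ X@(_ ∷ _)) (true ∷ Y@(false ∷ _)) Y⊆X tf = twinFree-⊆ X Y Y⊆X (proj₂ (to T-∧ tf))
twinFree-⊆ (true ∷ true ∷ _) (true ∷ true ∷ _) _ ()
twinFree-⊆ (true ∷ false ∷ _) (true ∷ true ∷ _) () _
twinFree-⊆ (false ∷ _ ∷ _) (true ∷ _ ∷ _) () _

Nested : ∀ {n m} → Vec (Subset n) m → Set
Nested = Linked (λ X Y → T (⊆ᵇ Y X))

-- Chain a Xs: Xs is a chain, and X₁ stays twin-free when a point of membership a
-- is put in front of it.  Chain false is the chain condition (isChain⇔chain).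
Chain : ∀ {n k} → Bool → Vec (Subset n) (suc k) → Set
Chain a (X ∷ Xs) = TwinFree (a ∷ X) × Nested (X ∷ Xs)

chain-irrelevant : ∀ {n k a} {Xs : Vec (Subset n) (suc k)} → Irrelevant (Chain a Xs)
chain-irrelevant {Xs = _ ∷ _} = ×-irrelevant T-irrelevant (Linked.irrelevant T-irrelevant)

isChain-irrelevant : ∀ {n k} {Xs : Vec (Subset n) k} → Irrelevant (IsChain Xs)
isChain-irrelevant {Xs = []} _ _ = refl
isChain-irrelevant {Xs = _ ∷ []} = T-irrelevant
isChain-irrelevant {Xs = _ ∷ Ys@(_ ∷ _)} =
  ×-irrelevant T-irrelevant (×-irrelevant T-irrelevant (isChain-irrelevant {Xs = Ys}))

twinFree-false∷ : ∀ {n} {X : Subset n} → TwinFree (false ∷ X) ⇔ TwinFree X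
twinFree-false∷ {X = []} = ⇔-id _
twinFree-false∷ {X = _ ∷ _} = ⇔-id _

isChain⇔chain : ∀ {n k} (Xs : Vec (Subset n) (suc k)) → IsChain Xs ⇔ Chain false Xs
isChain⇔chain Xs@(X ∷ _) = mk⇔ (Product.map (from (twinFree-false∷ {X = X})) id ∘ isChain⇒nested Xs)
                               (nested⇒isChain Xs ∘ Product.map (to (twinFree-false∷ {X = X})) id)
  where
  isChain⇒nested : ∀ {k} (Xs : Vec (Subset _) (suc k)) → IsChain Xs → TwinFree (head Xs) × Nested Xs
  isChain⇒nested (_ ∷ []) tf = tf , [-]
  isChain⇒nested (_ ∷ Ys@(_ ∷ _)) (tf , Y⊆X , c) = tf , Y⊆X ∷ proj₂ (isChain⇒nested Ys c)

  nested⇒isChain : ∀ {k} (Xs : Vec (Subset _) (suc k)) → TwinFree (head Xs) × Nested Xs → IsChain Xs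
  nested⇒isChain (_ ∷ []) (tf , _) = tf
  nested⇒isChain (X ∷ Ys@(Y ∷ _)) (tf , Y⊆X ∷ ns) =
    tf , Y⊆X , nested⇒isChain Ys (twinFree-⊆ X Y Y⊆X tf , ns)

columns↔ : ∀ {n m} → (Vec Bool m × Vec (Subset n) m) ↔ Vec (Subset (suc n)) m
columns↔ = mk↔ₛ′ (uncurry (zipWith _∷_)) (λ Xs → map head Xs , map tail Xs)
                 zip-unzip (uncurry unzip-zip)
  where
  zip-unzip : ∀ {n m} (Xs : Vec (Subset (suc n)) m) → zipWith _∷_ (map head Xs) (map tail Xs) ≡ Xs
  zip-unzip [] = refl
  zip-unzip ((a ∷ X) ∷ Xs) = cong ((a ∷ X) ∷_) (zip-unzip Xs)

  unzip-zip : ∀ {n m} (c : Vec Bool m) (Xs : Vec (Subset n) m) →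
              (map head (zipWith _∷_ c Xs) , map tail (zipWith _∷_ c Xs)) ≡ (c , Xs)
  unzip-zip [] [] = refl
  unzip-zip (a ∷ c) (X ∷ Xs) = cong (Product.map (a ∷_) (X ∷_)) (unzip-zip c Xs)

Σ-columns : ∀ {n m} {P : Vec (Subset (suc n)) m → Set} →
  Σ (Vec (Subset (suc n)) m) P ↔
  Σ (Vec Bool m) (λ c → Σ (Vec (Subset n) m) (λ Xs → P (zipWith _∷_ c Xs)))
Σ-columns = ↔-trans (↔-sym (Σ.cong columns↔ ↔-refl)) Σ-assoc

nested-zipWith⇔ : ∀ {n m} (c : Vec Bool m) (Xs : Vec (Subset n) m) →
                  Nested (zipWith _∷_ c Xs) ⇔ (Decreasing c × Nested Xs)
nested-zipWith⇔ c Xs = mk⇔ (Linked-zipWith⁻ _∷_ T-∧ c Xs) (uncurry (Linked-zipWith⁺ _∷_ T-∧))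

chain-zipWith⇔ : ∀ {n k} b (c : Vec Bool (suc k)) (Xs : Vec (Subset n) (suc k)) →
  Chain b (zipWith _∷_ c Xs) ⇔ (Decreasing c × (T (not (b ∧ head c)) × Chain (head c) Xs))
chain-zipWith⇔ b c@(a ∷ _) Xs@(X ∷ _) = mk⇔
  (λ (tf , ns) → let (b∦a , tfX) = to T-∧ tf ; (d , nXs) = to (nested-zipWith⇔ c Xs) ns
                 in d , b∦a , tfX , nXs)
  (λ (d , b∦a , tfX , nXs) → from T-∧ (b∦a , tfX) , from (nested-zipWith⇔ c Xs) (d , nXs))

module Counting (k : ℕ) where

  ChainsAfter : Bool → ℕ → Set
  ChainsAfter a n = Σ (Vec (Subset n) (suc k)) (Chain a)

  count : Bool → ℕ → ℕ
  count _ zero = 1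
  count false (suc n) = count false n + suc k * count true n
  count true (suc n) = count false n

  chainsAfter-zero : ∀ a → ChainsAfter a 0 ↔ ⊤
  chainsAfter-zero a =
    mk↔ₛ′ _ (λ _ → replicate (suc k) [] , tt , nested-empty (suc k)) (λ _ → refl)
          (λ (Xs , _) → Σ-≡-irrelevant chain-irrelevant (empty-unique Xs))
    where
    nested-empty : ∀ m → Nested (replicate m [])
    nested-empty zero = []
    nested-empty (suc zero) = [-]
    nested-empty (suc (suc m)) = tt ∷ nested-empty (suc m)

    empty-unique : ∀ {m} (Xs : Vec (Subset 0) m) → replicate m [] ≡ Xs
    empty-unique [] = refl
    empty-unique ([] ∷ Xs) = cong ([] ∷_) (empty-unique Xs)

  Guarded : Bool → Bool → ℕ → Set
  Guarded b a n = Σ (Vec (Subset n) (suc k)) (λ Xs → T (not (b ∧ a)) × Chain a Xs)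

  chainsAfter-suc : ∀ b n →
    ChainsAfter b (suc n) ↔ (Guarded b false n ⊎ Fin (suc k) × Guarded b true n)
  chainsAfter-suc b n = begin
    ChainsAfter b (suc n)
      ↔⟨ Σ-columns ⟩
    Σ (Vec Bool (suc k)) (λ c → Σ (Vec (Subset n) (suc k)) (λ Xs → Chain b (zipWith _∷_ c Xs)))
      ↔⟨ Σ.congˡ (Σ.congˡ (irrelevant-⇔⇒↔ chain-irrelevant
           (×-irrelevant decreasing-irrelevant (×-irrelevant T-irrelevant chain-irrelevant))
           (chain-zipWith⇔ b _ _))) ⟩
    Σ (Vec Bool (suc k)) (λ c → Σ (Vec (Subset n) (suc k))
                                  (λ Xs → Decreasing c × (T (not (b ∧ head c)) × Chain (head c) Xs)))
      ↔⟨ Σ.congˡ (∃∃↔∃∃ _) ⟩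
    Σ (Vec Bool (suc k)) (λ c → Decreasing c × Guarded b (head c) n)
      ↔⟨ Σ-decreasing {F = λ a → Guarded b a n} ⟩
    (Guarded b false n ⊎ Fin (suc k) × Guarded b true n) ∎
    where open EquationalReasoning

  unguard : ∀ {a n} → Guarded false a n ↔ ChainsAfter a n
  unguard = mk↔ₛ′ (Product.map id proj₂) (Product.map id (tt ,_)) (λ _ → refl) (λ _ → refl)

  chainsAfter-false-suc : ∀ n →
    ChainsAfter false (suc n) ↔ (ChainsAfter false n ⊎ Fin (suc k) × ChainsAfter true n)
  chainsAfter-false-suc n = ↔-trans (chainsAfter-suc false n) (unguard ⊎-↔ (↔-refl ×-↔ unguard))

  chainsAfter-true-suc : ∀ n → ChainsAfter true (suc n) ↔ ChainsAfter false n
  chainsAfter-true-suc n =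
    ↔-trans (chainsAfter-suc true n) (↔-trans (⊎-identityʳ-¬ λ { (_ , _ , () , _) }) unguard)

  chainsAfter↔Fin : ∀ a n → ChainsAfter a n ↔ Fin (count a n)
  chainsAfter↔Fin a zero = ↔-trans (chainsAfter-zero a) (↔-sym 1↔⊤)
  chainsAfter↔Fin false (suc n) =
    ↔-trans (chainsAfter-false-suc n)
      (↔-trans (chainsAfter↔Fin false n ⊎-↔ (↔-refl ×-↔ chainsAfter↔Fin true n))
               (↔-sym (↔-trans +↔⊎ (↔-refl ⊎-↔ *↔×))))
  chainsAfter↔Fin true (suc n) = ↔-trans (chainsAfter-true-suc n) (chainsAfter↔Fin false n)

  count-one : count false 1 ≡ suc k + 1
  count-one = trans (+-comm 1 (suc k * 1)) (cong (_+ 1) (*-identityʳ (suc k)))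

  count-recurrence : ∀ n → count false (suc (suc n)) ≡ count false (suc n) + suc k * count false n
  count-recurrence n = refl

  chains↔chainsAfter-false : ∀ n → Chains (suc k) (suc n) ↔ ChainsAfter false n
  chains↔chainsAfter-false n =
    Σ.congˡ λ {Xs} →
      irrelevant-⇔⇒↔ (isChain-irrelevant {Xs = Xs}) chain-irrelevant (isChain⇔chain Xs)

lemma15 : Σ (ℕ → ℕ → ℕ) λ M →
    ((d s : ℕ) → Chains (suc d) (suc s) ↔ Fin (M (suc d) (suc s)))
    × ((d : ℕ) → M (suc d) 1 ≡ 1)
    × ((d : ℕ) → M (suc d) 2 ≡ suc d + 1)
    × ((d s : ℕ) → M (suc d) (s + 3) ≡ M (suc d) (s + 2) + suc d * M (suc d) (s + 1))
-- pred only shifts indices: M is specified for d, s ≥ 1 alone.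
lemma15 = (λ d s → count (pred d) false (pred s))
        , (λ d s → ↔-trans (chains↔chainsAfter-false d s) (chainsAfter↔Fin d false s))
        , (λ _ → refl)
        , count-one
        , recurrence
  where
  open Counting

  recurrence : ∀ d s → count d false (pred (s + 3))
                       ≡ count d false (pred (s + 2)) + suc d * count d false (pred (s + 1))
  recurrence d s rewrite +-comm s 3 | +-comm s 2 | +-comm s 1 = count-recurrence d s
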